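{- Let $d$ be even and consider the hyperbolic quadric $Q^+(2d-1,q)$ of rank $d$ (parameter $e=0$). For every integer $i$ with $1\le i\le d/2$ and every $j\in\{0,\dots,d\}\setminus\{1,d-1\}$, one has $P_{j,2i}\neq P_{1,2i}$; that is, for the association scheme on one class of generators (relations $R_i'=R_{2i}$, eigenspaces $V'_j=V_j\perp V_{d-j}$ restricted to that class), the eigenvalue $P_{1,2i}$ of $A'_i=A_{2i}$ corresponds only with the eigenspace $V'_1=V_1\perp V_{d-1}$.
   Context: For $Q^+(2d-1,q)$, generators are totally singular $(d-1)$-dimensional projective subspaces; they split into two classes such that two generators lie in the same class iff the dimension of their intersection is $\equiv d\pmod 2$. On generators, $(\pi,\pi')\in R_i$ iff $\dim(\pi\cap\pi')=d-i-1$, $A_i$ is its adjacency matrix, and the common eigenspaces $V_0,\dots,V_d$ (classical order) have $A_i$ acting on $V_j$ by $P_{ji}=\sum_{s=\max(0,j-i)}^{\min(j,d-i)}(-1)^{j+s}\begin{bmatrix} j\\ s\end{bmatrix}_q\begin{bmatrix} d-j\\ d-i-s\end{bmatrix}_q q^{\binom{j-s}{2}+\binom{i+s-j}{2}}$, with Gaussian binomials $\begin{bmatrix} a\\ b\end{bmatrix}_q=\prod_{k=1}^b\frac{q^{a-b+k}-1}{q^k-1}$. Restricting the even relations $R_{2i}$ ($0\le i\le d/2$) to one class gives an association scheme with relations $R'_i$, matrices $A'_i$, and eigenspaces $V'_j$ ($0\le j\le d/2$) equal to $V_j\perp V_{d-j}$ restricted to that class. -}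

module Defs where

open import Data.Nat using (ℕ; zero; suc; _+_; _*_; _∸_; _^_; _⊓_)
open import Data.Nat.DivMod using (_/_)
open import Data.Nat.Combinatorics using (_C_)
open import Data.List using (List; map; upTo; foldr)
open import Data.Nat.ListAction using (product)
open import Data.Integer as ℤ using (ℤ; +_)

div : ℕ → ℕ → ℕ
div m zero    = 0
div m (suc n) = m / suc n

-- Gaussian binomial [a b]_q = ∏_{k=1}^b (q^(a-b+k) - 1) / (q^k - 1)
-- (used only with b ≤ a; the product is exactly divisible for q ≥ 2)
gauss : ℕ → ℕ → ℕ → ℕ
gauss q a b =
  div (product (map (λ k → q ^ (a ∸ b + suc k) ∸ 1) (upTo b)))
      (product (map (λ k → q ^ suc k ∸ 1) (upTo b)))

sign : ℕ → ℤ
sign zero          = + 1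
sign (suc zero)    = ℤ.- (+ 1)
sign (suc (suc n)) = sign n

range : ℕ → ℕ → List ℕ
range lo hi = map (λ t → lo + t) (upTo (suc hi ∸ lo))

-- P_{j i} for the generators of Q^+(2d-1,q):
-- sum_{s = max(0,j-i)}^{min(j,d-i)} (-1)^(j+s) [j s]_q [d-j, d-i-s]_q q^(C(j-s,2)+C(i+s-j,2))
P : (q d j i : ℕ) → ℤ
P q d j i = foldr ℤ._+_ (+ 0) (map term (range (j ∸ i) (j ⊓ (d ∸ i))))
  where
  term : ℕ → ℤ
  term s = sign (j + s) ℤ.* (+ (gauss q j s * gauss q (d ∸ j) (d ∸ i ∸ s)
                                 * q ^ ((j ∸ s) C 2 + (i + s ∸ j) C 2)))

module Submission where

-- Each summand of P_{j,2i} is ± [j,s]_q [d-j,d-2i-s]_q q^e with e = C(a,2) + C(b,2), where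
-- a = j - s and b = 2i + s - j sum to 2i.  Gaussian binomials are ≡ 1 (mod q), and for fixed
-- a + b the exponent strictly decreases as min(a,b) grows.  Over the summation range min(a,b)
-- attains a unique maximum w (w = j, i or d - j according to where j lies), so
-- P_{j,2i} ≡ ±q^v (mod q^(v+1)) with v = C(w,2) + C(2i-w,2), and two eigenvalues with different w
-- are different.  This separates P_{1,2i} (w = 1) from every P_{j,2i} except for i = 1 and
-- 2 ≤ j ≤ d-2, where evaluating the (two- and three-term) sums gives
-- (q-1)(q²-1)(P_{1,2} - P_{j,2}) = q² (q^(2j-2) - 1) (q^(2d-2j-2) - 1) ≠ 0.

open import Defs
open import Data.Product using (∃; _×_; _,_)
open import Relation.Binary.PropositionalEquality

module GaussianBinomials where

  open import Data.Nat
  open import Data.Nat.Properties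
  open import Data.Nat.DivMod using (m*n/n≡m)
  open import Data.Nat.ListAction using (product)
  open import Data.Nat.Tactic.RingSolver using (solve-∀)
  open import Data.List using (applyUpTo)
  open import Data.List.Properties using (map-upTo)
  open import Function using (_∘_)

  ∏ : ℕ → (ℕ → ℕ) → ℕ
  ∏ n f = product (applyUpTo f n)

  ∏-cong : ∀ n {f g} → (∀ k → f k ≡ g k) → ∏ n f ≡ ∏ n g
  ∏-cong zero    f≗g = refl
  ∏-cong (suc n) f≗g = cong₂ _*_ (f≗g 0) (∏-cong n (f≗g ∘ suc))

  ∏-suc : ∀ n f → ∏ (suc n) f ≡ ∏ n f * f n
  ∏-suc zero    f = *-comm (f 0) 1
  ∏-suc (suc n) f = trans (cong (f 0 *_) (∏-suc n (f ∘ suc))) (sym (*-assoc (f 0) _ _))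

  ∏-nonZero : ∀ n {f} → (∀ k → NonZero (f k)) → NonZero (∏ n f)
  ∏-nonZero zero    f≢0 = _
  ∏-nonZero (suc n) f≢0 = m*n≢0 _ _ {{f≢0 0}} {{∏-nonZero n (f≢0 ∘ suc)}}

  div-*-cancel : ∀ m n .{{_ : NonZero n}} → div (m * n) n ≡ m
  div-*-cancel m (suc n) = m*n/n≡m m (suc n)

  module _ (q : ℕ) where

    -- qBinomial q c b is the Gaussian binomial [c + b, b]_q, built by the q-Pascal rule.
    qBinomial : ℕ → ℕ → ℕ
    qBinomial zero    b       = 1
    qBinomial (suc c) zero    = 1
    qBinomial (suc c) (suc b) = qBinomial (suc c) b + q ^ suc b * qBinomial c (suc b)

    qBinomial≡1+q* : ∀ c b → ∃ λ k → qBinomial c b ≡ 1 + q * k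
    qBinomial≡1+q* zero    b       = 0 , cong suc (sym (*-zeroʳ q))
    qBinomial≡1+q* (suc c) zero    = 0 , cong suc (sym (*-zeroʳ q))
    qBinomial≡1+q* (suc c) (suc b) with qBinomial≡1+q* (suc c) b
    ... | k , eq = k + q ^ b * qBinomial c (suc b) ,
        trans (cong (_+ q ^ suc b * qBinomial c (suc b)) eq) (regroup q k (q ^ b) (qBinomial c (suc b)))
      where
      regroup : ∀ q k x y → 1 + q * k + q * x * y ≡ 1 + q * (k + x * y)
      regroup = solve-∀

    q^-∸1 : ℕ → ℕ
    q^-∸1 k = q ^ k ∸ 1

    q^-∸1-∏ : ℕ → ℕ → ℕ
    q^-∸1-∏ c b = ∏ b (λ k → q^-∸1 (c + suc k))

    q^-∸1-∏-suc : ∀ c b → q^-∸1-∏ c (suc b) ≡ q^-∸1 (suc c) * q^-∸1-∏ (suc c) b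
    q^-∸1-∏-suc c b =
      cong₂ _*_ (cong q^-∸1 (+-comm c 1)) (∏-cong b (λ k → cong q^-∸1 (+-suc c (suc k))))

  module _ (q : ℕ) .{{_ : NonZero q}} where

    q^-∸1-+ : ∀ m n → q^-∸1 q (m + n) ≡ q^-∸1 q m + q ^ m * q^-∸1 q n
    q^-∸1-+ m n with q ^ m | q ^ n | m^n>0 q m | m^n>0 q n | ^-distribˡ-+-* q m n
    ... | suc x | suc y | _ | _ | eq = trans (cong (_∸ 1) eq) (expand x y)
      where
      expand : ∀ x y → y + x * suc y ≡ x + suc x * y
      expand = solve-∀

    qBinomial*q^-∸1-∏ : ∀ c b → qBinomial q c b * q^-∸1-∏ q 0 b ≡ q^-∸1-∏ q c b
    qBinomial*q^-∸1-∏ zero    b       = *-identityˡ _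
    qBinomial*q^-∸1-∏ (suc c) zero    = refl
    qBinomial*q^-∸1-∏ (suc c) (suc b) = begin
        G (suc c) (suc b) * D (suc b)
      ≡⟨ cong (G (suc c) (suc b) *_) (∏-suc b _) ⟩
        (G (suc c) b + q ^ suc b * G c (suc b)) * (D b * H (suc b))
      ≡⟨ distrib (G (suc c) b) (q ^ suc b) (G c (suc b)) (D b) (H (suc b)) ⟩
        G (suc c) b * D b * H (suc b) + q ^ suc b * (G c (suc b) * (D b * H (suc b)))
      ≡⟨ cong₂ (λ x y → x * H (suc b) + q ^ suc b * y)
               (qBinomial*q^-∸1-∏ (suc c) b)
               (trans (cong (G c (suc b) *_) (sym (∏-suc b _))) (qBinomial*q^-∸1-∏ c (suc b))) ⟩
        N (suc c) b * H (suc b) + q ^ suc b * N c (suc b)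
      ≡⟨ cong (λ x → N (suc c) b * H (suc b) + q ^ suc b * x) (q^-∸1-∏-suc q c b) ⟩
        N (suc c) b * H (suc b) + q ^ suc b * (H (suc c) * N (suc c) b)
      ≡⟨ factor (N (suc c) b) (H (suc b)) (q ^ suc b) (H (suc c)) ⟩
        N (suc c) b * (H (suc b) + q ^ suc b * H (suc c))
      ≡⟨ cong (N (suc c) b *_) (sym (q^-∸1-+ (suc b) (suc c))) ⟩
        N (suc c) b * H (suc b + suc c)
      ≡⟨ cong (λ x → N (suc c) b * H x) (+-comm (suc b) (suc c)) ⟩
        N (suc c) b * H (suc c + suc b)
      ≡⟨ sym (∏-suc b _) ⟩
        N (suc c) (suc b) ∎
      where
      open ≡-Reasoning
      G = qBinomial q
      H = q^-∸1 q
      N = q^-∸1-∏ q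
      D = q^-∸1-∏ q 0
      distrib : ∀ a b c d e → (a + b * c) * (d * e) ≡ a * d * e + b * (c * (d * e))
      distrib = solve-∀
      factor : ∀ n h x h′ → n * h + x * (h′ * n) ≡ n * (h + x * h′)
      factor = solve-∀

  module _ (q : ℕ) (1<q : 1 < q) where

    private instance
      q≢0 : NonZero q
      q≢0 = >-nonZero (<-trans z<s 1<q)

    q^-∸1-∏-nonZero : ∀ c b → NonZero (q^-∸1-∏ q c b)
    q^-∸1-∏-nonZero c b =
      ∏-nonZero b (λ k → >-nonZero (m<n⇒0<n∸m (^-monoʳ-< q 1<q (≤-trans (s≤s z≤n) (m≤n+m (suc k) c)))))

    gauss≡qBinomial : ∀ a b → gauss q a b ≡ qBinomial q (a ∸ b) b
    gauss≡qBinomial a b = begin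
      gauss q a b
        ≡⟨ cong₂ div (cong product (map-upTo _ b)) (cong product (map-upTo _ b)) ⟩
      div (q^-∸1-∏ q (a ∸ b) b) (q^-∸1-∏ q 0 b)
        ≡⟨ cong (λ x → div x (q^-∸1-∏ q 0 b)) (sym (qBinomial*q^-∸1-∏ q (a ∸ b) b)) ⟩
      div (qBinomial q (a ∸ b) b * q^-∸1-∏ q 0 b) (q^-∸1-∏ q 0 b)
        ≡⟨ div-*-cancel _ _ {{q^-∸1-∏-nonZero 0 b}} ⟩
      qBinomial q (a ∸ b) b ∎
      where open ≡-Reasoning

open GaussianBinomials

module BinomialExponents where

  open import Data.Nat
  open import Data.Nat.Properties
  open import Data.Nat.Combinatorics using (_C_; nC1≡n; nCk+nC[k+1]≡[n+1]C[k+1])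
  open import Data.Nat.Tactic.RingSolver using (solve-∀)
  open import Data.Sum using (inj₁; inj₂)

  [1+n]C2 : ∀ n → suc n C 2 ≡ n + n C 2
  [1+n]C2 n = trans (sym (nCk+nC[k+1]≡[n+1]C[k+1] n 1)) (cong (_+ n C 2) (nC1≡n n))

  [m+n]C2 : ∀ m n → (m + n) C 2 ≡ m C 2 + n C 2 + m * n
  [m+n]C2 zero    n = sym (+-identityʳ (n C 2))
  [m+n]C2 (suc m) n = begin
    suc (m + n) C 2                  ≡⟨ [1+n]C2 (m + n) ⟩
    m + n + (m + n) C 2              ≡⟨ cong (m + n +_) ([m+n]C2 m n) ⟩
    m + n + (m C 2 + n C 2 + m * n)  ≡⟨ regroup m n (m C 2) (n C 2) ⟩
    m + m C 2 + n C 2 + (n + m * n)  ≡⟨ cong (λ x → x + n C 2 + (n + m * n)) ([1+n]C2 m) ⟨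
    suc m C 2 + n C 2 + suc m * n    ∎
    where
    open ≡-Reasoning
    regroup : ∀ m n x y → m + n + (x + y + m * n) ≡ m + x + y + (n + m * n)
    regroup = solve-∀

  m⊓n+m⊔n≡m+n : ∀ m n → m ⊓ n + (m ⊔ n) ≡ m + n
  m⊓n+m⊔n≡m+n m n with ≤-total m n
  ... | inj₁ m≤n = cong₂ _+_ (m≤n⇒m⊓n≡m m≤n) (m≤n⇒m⊔n≡n m≤n)
  ... | inj₂ n≤m = trans (cong₂ _+_ (m≥n⇒m⊓n≡n n≤m) (m≥n⇒m⊔n≡m n≤m)) (+-comm n m)

  m*n≡[m⊓n]*[m⊔n] : ∀ m n → m * n ≡ (m ⊓ n) * (m ⊔ n)
  m*n≡[m⊓n]*[m⊔n] m n with ≤-total m n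
  ... | inj₁ m≤n = sym (cong₂ _*_ (m≤n⇒m⊓n≡m m≤n) (m≤n⇒m⊔n≡n m≤n))
  ... | inj₂ n≤m = trans (*-comm m n) (sym (cong₂ _*_ (m≥n⇒m⊓n≡n n≤m) (m≥n⇒m⊔n≡m n≤m)))

  *-<-of-spread : ∀ {x y z w} → x < y → y ≤ z → x + w ≡ y + z → x * w < y * z
  *-<-of-spread {x} {y} {z} {w} x<y y≤z eq with m≤n⇒∃[o]m+o≡n x<y | m≤n⇒∃[o]m+o≡n y≤z
  ... | δ , refl | f , refl = subst (λ v → x * v < (suc x + δ) * (suc x + δ + f)) (sym w≡) spread
    where
    w≡ : w ≡ suc δ + (suc x + δ + f)
    w≡ = +-cancelˡ-≡ x w _ (trans eq (shift x δ f))
      where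
      shift : ∀ x δ f → suc x + δ + (suc x + δ + f) ≡ x + (suc δ + (suc x + δ + f))
      shift = solve-∀
    spread : x * (suc δ + (suc x + δ + f)) < (suc x + δ) * (suc x + δ + f)
    spread = subst (x * (suc δ + (suc x + δ + f)) <_) (sym (expand x δ f)) (m<m+n _ z<s)
      where
      expand : ∀ x δ f → (suc x + δ) * (suc x + δ + f) ≡ x * (suc δ + (suc x + δ + f)) + suc δ * (suc δ + f)
      expand = solve-∀

  *-<-more-balanced : ∀ a b a′ b′ → a + b ≡ a′ + b′ → a ⊓ b < a′ ⊓ b′ → a * b < a′ * b′
  *-<-more-balanced a b a′ b′ eq lt =
    subst₂ _<_ (sym (m*n≡[m⊓n]*[m⊔n] a b)) (sym (m*n≡[m⊓n]*[m⊔n] a′ b′))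
      (*-<-of-spread lt (m⊓n≤m⊔n a′ b′)
        (trans (m⊓n+m⊔n≡m+n a b) (trans eq (sym (m⊓n+m⊔n≡m+n a′ b′)))))

  C2+C2-<-more-balanced : ∀ a b a′ b′ → a + b ≡ a′ + b′ → a ⊓ b < a′ ⊓ b′ →
                          a′ C 2 + b′ C 2 < a C 2 + b C 2
  C2+C2-<-more-balanced a b a′ b′ eq lt = +-cancelʳ-< (a′ * b′) _ _ (begin-strict
    a′ C 2 + b′ C 2 + a′ * b′ ≡⟨ [m+n]C2 a′ b′ ⟨
    (a′ + b′) C 2             ≡⟨ cong (_C 2) eq ⟨
    (a + b) C 2               ≡⟨ [m+n]C2 a b ⟩
    a C 2 + b C 2 + a * b     <⟨ +-monoʳ-< (a C 2 + b C 2) (*-<-more-balanced a b a′ b′ eq lt) ⟩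
    a C 2 + b C 2 + a′ * b′   ∎)
    where open ≤-Reasoning

open BinomialExponents

module Congruences where

  open import Data.Nat as ℕ using (ℕ; zero; suc; _^_; _≤_; _<_; z<s; s<s)
  import Data.Nat.Properties as ℕ
  open import Data.Integer using (ℤ; +_; _+_; _*_; -_; 0ℤ)
  import Data.Integer.Properties as ℤ
  open import Data.Integer.Tactic.RingSolver using (solve-∀)
  open import Data.List using (foldr; applyUpTo)
  open import Function using (_∘_)

  -- A record rather than a Σ-type, so that unification can recover the modulus.
  infix 4 _≡_mod_
  record _≡_mod_ (x y m : ℤ) : Set where
    constructor witness
    field
      quotient : ℤ
      equation : x ≡ y + m * quotient

  ≡-mod-refl : ∀ {m} x → x ≡ x mod m
  ≡-mod-refl {m} x = witness 0ℤ (sym (trans (cong (_+_ x) (ℤ.*-zeroʳ m)) (ℤ.+-identityʳ x)))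

  ≡-mod-sym : ∀ {m x y} → x ≡ y mod m → y ≡ x mod m
  ≡-mod-sym {m} {x} {y} (witness k refl) = witness (- k) (cancel y m k)
    where
    cancel : ∀ y m k → y ≡ y + m * k + m * - k
    cancel = solve-∀

  ≡-mod-trans : ∀ {m x y z} → x ≡ y mod m → y ≡ z mod m → x ≡ z mod m
  ≡-mod-trans {m} {z = z} (witness k refl) (witness l refl) = witness (l + k) (regroup z m l k)
    where
    regroup : ∀ z m l k → z + m * l + m * k ≡ z + m * (l + k)
    regroup = solve-∀

  ≡-mod-+ : ∀ {m x x′ y y′} → x ≡ x′ mod m → y ≡ y′ mod m → x + y ≡ x′ + y′ mod m
  ≡-mod-+ {m} {x′ = x′} {y′ = y′} (witness k refl) (witness l refl) = witness (k + l) (regroup x′ y′ m k l)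
    where
    regroup : ∀ x y m k l → x + m * k + (y + m * l) ≡ x + y + m * (k + l)
    regroup = solve-∀

  ≡-mod-*ˡ : ∀ {m x y} c → x ≡ y mod m → c * x ≡ c * y mod m
  ≡-mod-*ˡ {m} {y = y} c (witness k refl) = witness (c * k) (regroup c y m k)
    where
    regroup : ∀ c y m k → c * (y + m * k) ≡ c * y + m * (c * k)
    regroup = solve-∀

  ≡-mod-∣ : ∀ {m n x y} c → m ≡ n * c → x ≡ y mod m → x ≡ y mod n
  ≡-mod-∣ {n = n} {y = y} c refl (witness k refl) = witness (c * k) (cong (_+_ y) (ℤ.*-assoc n c k))

  *-≡0-mod : ∀ m k → m * k ≡ 0ℤ mod m
  *-≡0-mod m k = witness k (sym (ℤ.+-identityˡ (m * k)))

  ∑ : ℕ → (ℕ → ℤ) → ℤ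
  ∑ n g = foldr _+_ 0ℤ (applyUpTo g n)

  ∑-≡0-mod : ∀ {m} n g → (∀ t → t < n → g t ≡ 0ℤ mod m) → ∑ n g ≡ 0ℤ mod m
  ∑-≡0-mod zero    g g≡0 = ≡-mod-refl 0ℤ
  ∑-≡0-mod (suc n) g g≡0 =
    ≡-mod-+ (g≡0 0 z<s) (∑-≡0-mod n (g ∘ suc) (λ t t<n → g≡0 (suc t) (s<s t<n)))

  ∑-≡-single-mod : ∀ {m} n g {k} → k < n → (∀ t → t < n → t ≢ k → g t ≡ 0ℤ mod m) →
                   ∑ n g ≡ g k mod m
  ∑-≡-single-mod {m} (suc n) g {zero} _ others =
    subst (λ x → ∑ (suc n) g ≡ x mod m) (ℤ.+-identityʳ (g 0))
      (≡-mod-+ (≡-mod-refl (g 0))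
        (∑-≡0-mod n (g ∘ suc) (λ t t<n → others (suc t) (s<s t<n) λ ())))
  ∑-≡-single-mod {m} (suc n) g {suc k} (s<s k<n) others =
    subst (λ x → ∑ (suc n) g ≡ x mod m) (ℤ.+-identityˡ (g (suc k)))
      (≡-mod-+ (others 0 z<s λ ())
        (∑-≡-single-mod n (g ∘ suc) k<n
          (λ t t<n t≢k → others (suc t) (s<s t<n) (t≢k ∘ ℕ.suc-injective))))

  ∑-range-≡-single-mod : ∀ {m} lo hi (g : ℕ → ℤ) {s*} → lo ≤ s* → s* ≤ hi →
    (∀ s → lo ≤ s → s ≤ hi → s ≢ s* → g s ≡ 0ℤ mod m) →
    ∑ (suc hi ℕ.∸ lo) (λ t → g (lo ℕ.+ t)) ≡ g s* mod m
  ∑-range-≡-single-mod {m} lo hi g {s*} lo≤s* s*≤hi others =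
    subst (λ s → ∑ (suc hi ℕ.∸ lo) (λ t → g (lo ℕ.+ t)) ≡ g s mod m) (ℕ.m+[n∸m]≡n lo≤s*)
      (∑-≡-single-mod (suc hi ℕ.∸ lo) (λ t → g (lo ℕ.+ t)) (ℕ.∸-monoˡ-< (s<s s*≤hi) lo≤s*)
        (λ t t<n t≢k → others (lo ℕ.+ t) (ℕ.m≤m+n lo t) (index≤hi t t<n)
           (λ eq → t≢k (trans (sym (ℕ.m+n∸m≡n lo t)) (cong (ℕ._∸ lo) eq)))))
    where
    index≤hi : ∀ t → t < suc hi ℕ.∸ lo → lo ℕ.+ t ≤ hi
    index≤hi t t<n = ℕ.s≤s⁻¹ (subst (_≤ suc hi) (trans (ℕ.+-comm (suc t) lo) (ℕ.+-suc lo t))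
      (ℕ.m≤o∸n⇒m+n≤o (suc t) (ℕ.<⇒≤ (ℕ.m∸n≢0⇒n<m λ eq → ℕ.<⇒≱ (subst (t <_) eq t<n) ℕ.z≤n)) t<n))

open Congruences

module LeadingTerms where

  open import Data.Nat as ℕ using (ℕ; zero; suc; _∸_; _^_; _≤_; _<_; _⊓_; z<s; s<s; NonZero)
  import Data.Nat.Properties as ℕ
  import Data.Nat.Tactic.RingSolver as ℕ-Solver
  open import Data.Nat.Combinatorics using (_C_)
  open import Data.Integer using (ℤ; +_; _+_; _*_; ∣_∣; 0ℤ)
  import Data.Integer.Properties as ℤ
  open import Data.Integer.Tactic.RingSolver using (solve-∀)
  open import Data.List using (foldr; map)
  open import Data.List.Properties using (map-upTo; map-applyUpTo)
  open import Function using (_∘_)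
  open import Relation.Nullary using (¬_)

  exponent : ℕ → ℕ → ℕ → ℕ
  exponent j i s = (j ∸ s) C 2 ℕ.+ (i ℕ.+ s ∸ j) C 2

  module _ (q : ℕ) where

    term : ℕ → ℕ → ℕ → ℕ → ℤ
    term d j i s = sign (j ℕ.+ s) * + (gauss q j s ℕ.* gauss q (d ∸ j) (d ∸ i ∸ s) ℕ.* q ^ exponent j i s)

    P≡∑ : ∀ d j i → P q d j i ≡ ∑ (suc (j ⊓ (d ∸ i)) ∸ (j ∸ i)) (term d j i ∘ (j ∸ i ℕ.+_))
    P≡∑ d j i = cong (foldr _+_ 0ℤ)
      (trans (cong (map (term d j i)) (map-upTo (j ∸ i ℕ.+_) n)) (map-applyUpTo _ (term d j i) n))
      where n = suc (j ⊓ (d ∸ i)) ∸ (j ∸ i)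

    HasLeadingExponent : ℤ → ℕ → Set
    HasLeadingExponent x v = ∃ λ n → x ≡ sign n * + (q ^ v) mod + (q ^ suc v)

    +q^-split : ∀ {v e} → v ≤ e → + (q ^ e) ≡ + (q ^ v) * + (q ^ (e ∸ v))
    +q^-split {v} {e} v≤e = trans (cong (λ x → + (q ^ x)) (sym (ℕ.m+[n∸m]≡n v≤e)))
      (trans (cong +_ (ℕ.^-distribˡ-+-* q v (e ∸ v))) (ℤ.pos-* (q ^ v) (q ^ (e ∸ v))))

    *q^-≡0-mod : ∀ c {v e} → v < e → c * + (q ^ e) ≡ 0ℤ mod + (q ^ suc v)
    *q^-≡0-mod c {v} {e} v<e =
      subst (_≡ 0ℤ mod _) (sym (trans (cong (c *_) (+q^-split v<e)) (swap c M R))) (*-≡0-mod M (c * R))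
      where
      M = + (q ^ suc v)
      R = + (q ^ (e ∸ suc v))
      swap : ∀ c m r → c * (m * r) ≡ m * (c * r)
      swap = solve-∀

    term-≡0-mod : ∀ d j i s {v} → v < exponent j i s → term d j i s ≡ 0ℤ mod + (q ^ suc v)
    term-≡0-mod d j i s v<e =
      subst (_≡ 0ℤ mod _) (sym (reassoc (sign (j ℕ.+ s)) A (q ^ exponent j i s)))
        (*q^-≡0-mod (sign (j ℕ.+ s) * + A) v<e)
      where
      A = gauss q j s ℕ.* gauss q (d ∸ j) (d ∸ i ∸ s)
      reassoc : ∀ c a x → c * + (a ℕ.* x) ≡ c * + a * + x
      reassoc c a x = trans (cong (c *_) (ℤ.pos-* a x)) (sym (ℤ.*-assoc c (+ a) (+ x)))

  ∣sign∣≡1 : ∀ n → ∣ sign n ∣ ≡ 1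
  ∣sign∣≡1 zero          = refl
  ∣sign∣≡1 (suc zero)    = refl
  ∣sign∣≡1 (suc (suc n)) = ∣sign∣≡1 n

  module _ (q : ℕ) (1<q : 1 < q) where

    private instance
      q≢0 : NonZero q
      q≢0 = ℕ.>-nonZero (ℕ.<-trans z<s 1<q)

    gauss*gauss≡1+q* : ∀ a b c e → ∃ λ k → gauss q a b ℕ.* gauss q c e ≡ 1 ℕ.+ q ℕ.* k
    gauss*gauss≡1+q* a b c e with qBinomial≡1+q* q (a ∸ b) b | qBinomial≡1+q* q (c ∸ e) e
    ... | k , eq | l , eq′ = k ℕ.+ l ℕ.+ q ℕ.* k ℕ.* l ,
      trans (cong₂ ℕ._*_ (trans (gauss≡qBinomial q 1<q a b) eq) (trans (gauss≡qBinomial q 1<q c e) eq′))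
            (expand q k l)
      where
      expand : ∀ q k l → (1 ℕ.+ q ℕ.* k) ℕ.* (1 ℕ.+ q ℕ.* l) ≡ 1 ℕ.+ q ℕ.* (k ℕ.+ l ℕ.+ q ℕ.* k ℕ.* l)
      expand = ℕ-Solver.solve-∀

    term-leading : ∀ d j i s → HasLeadingExponent q (term q d j i s) (exponent j i s)
    term-leading d j i s with gauss*gauss≡1+q* j s (d ∸ j) (d ∸ i ∸ s)
    ... | k , eq = j ℕ.+ s , ≡-mod-*ˡ (sign (j ℕ.+ s)) (witness (+ k) (begin
        + (gauss q j s ℕ.* gauss q (d ∸ j) (d ∸ i ∸ s) ℕ.* q ^ e) ≡⟨ cong (λ x → + (x ℕ.* q ^ e)) eq ⟩
        + ((1 ℕ.+ q ℕ.* k) ℕ.* q ^ e)                            ≡⟨ cong +_ (expand q k (q ^ e)) ⟩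
        + (q ^ e ℕ.+ q ℕ.* q ^ e ℕ.* k)                           ≡⟨ ℤ.pos-+ (q ^ e) _ ⟩
        + (q ^ e) + + (q ^ suc e ℕ.* k)                           ≡⟨ cong (_+_ (+ (q ^ e))) (ℤ.pos-* (q ^ suc e) k) ⟩
        + (q ^ e) + + (q ^ suc e) * + k                           ∎))
      where
      open ≡-Reasoning
      e = exponent j i s
      expand : ∀ q k x → (1 ℕ.+ q ℕ.* k) ℕ.* x ≡ x ℕ.+ q ℕ.* x ℕ.* k
      expand = ℕ-Solver.solve-∀

    sign*q^-≢0-mod : ∀ n v → ¬ (sign n * + (q ^ v) ≡ 0ℤ mod + (q ^ suc v))
    sign*q^-≢0-mod n v (witness k eq) = ℕ.<⇒≢ 1<q (sym (ℕ.m*n≡1⇒m≡1 q ∣ k ∣ (sym 1≡q*∣k∣)))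
      where
      instance
        q^v≢0 : NonZero (q ^ v)
        q^v≢0 = ℕ.m^n≢0 q v
      1≡q*∣k∣ : 1 ≡ q ℕ.* ∣ k ∣
      1≡q*∣k∣ = ℕ.*-cancelˡ-≡ 1 (q ℕ.* ∣ k ∣) (q ^ v) (begin
        q ^ v ℕ.* 1                ≡⟨ ℕ.*-identityʳ (q ^ v) ⟩
        q ^ v                      ≡⟨ trans (cong (ℕ._* q ^ v) (∣sign∣≡1 n)) (ℕ.*-identityˡ (q ^ v)) ⟨
        ∣ sign n ∣ ℕ.* q ^ v       ≡⟨ ℤ.abs-* (sign n) (+ (q ^ v)) ⟨
        ∣ sign n * + (q ^ v) ∣     ≡⟨ cong ∣_∣ (trans eq (ℤ.+-identityˡ (+ (q ^ suc v) * k))) ⟩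
        ∣ + (q ^ suc v) * k ∣      ≡⟨ ℤ.abs-* (+ (q ^ suc v)) k ⟩
        q ℕ.* q ^ v ℕ.* ∣ k ∣      ≡⟨ rearrange q (q ^ v) ∣ k ∣ ⟩
        q ^ v ℕ.* (q ℕ.* ∣ k ∣)    ∎)
        where
        open ≡-Reasoning
        rearrange : ∀ q x k → q ℕ.* x ℕ.* k ≡ x ℕ.* (q ℕ.* k)
        rearrange = ℕ-Solver.solve-∀

    leading-≢ : ∀ {x y v w} → HasLeadingExponent q x v → HasLeadingExponent q y w → v < w → x ≢ y
    leading-≢ {v = v} (n , x≡) (n′ , y≡) v<w refl =
      sign*q^-≢0-mod n v (≡-mod-trans (≡-mod-sym x≡)
        (≡-mod-trans (≡-mod-∣ _ (+q^-split q (s<s (ℕ.<⇒≤ v<w))) y≡) (*q^-≡0-mod q (sign n′) v<w)))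

open LeadingTerms

module Balance where

  open import Data.Nat as ℕ using (ℕ; _+_; _∸_; _≤_; _<_; _⊓_)
  open import Data.Nat.Properties
  import Data.Nat.Tactic.RingSolver as ℕ-Solver
  open import Relation.Binary.Definitions using (tri<; tri≈; tri>)
  open import Relation.Nullary using (contradiction)

  InRange : ℕ → ℕ → ℕ → ℕ → Set
  InRange d j i s = j ∸ i ≤ s × s ≤ j ⊓ (d ∸ i)

  balance : ℕ → ℕ → ℕ → ℕ
  balance j i s = (j ∸ s) ⊓ (i + s ∸ j)

  parts-sum : ∀ {d j i s} → InRange d j i s → (j ∸ s) + (i + s ∸ j) ≡ i
  parts-sum {d} {j} {i} {s} (lo≤s , s≤hi) = +-cancelʳ-≡ s _ _ (begin
    (j ∸ s) + (i + s ∸ j) + s   ≡⟨ rearrange (j ∸ s) (i + s ∸ j) s ⟩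
    (i + s ∸ j) + ((j ∸ s) + s) ≡⟨ cong ((i + s ∸ j) +_) (m∸n+n≡m (≤-trans s≤hi (m⊓n≤m j (d ∸ i)))) ⟩
    (i + s ∸ j) + j             ≡⟨ m∸n+n≡m (≤-trans (m≤n+m∸n j i) (+-monoʳ-≤ i lo≤s)) ⟩
    i + s                       ∎)
    where
    open ≡-Reasoning
    rearrange : ∀ a b s → a + b + s ≡ b + (a + s)
    rearrange = ℕ-Solver.solve-∀

  exponent-<-of-balance-< : ∀ {d j j′ i s s′} → InRange d j i s → InRange d j′ i s′ →
                            balance j i s < balance j′ i s′ → exponent j′ i s′ < exponent j i s
  exponent-<-of-balance-< s∈ s′∈ =
    C2+C2-<-more-balanced _ _ _ _ (trans (parts-sum s∈) (sym (parts-sum s′∈)))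

  record UniqueMaxBalance (d j i w : ℕ) : Set where
    constructor max-at
    field
      argmax  : ℕ
      inRange : InRange d j i argmax
      max≡    : balance j i argmax ≡ w
      others< : ∀ s → InRange d j i s → s ≢ argmax → balance j i s < w

  m+n≡o+o∧m≢o⇒m⊓n<o : ∀ {m n o} → m + n ≡ o + o → m ≢ o → m ⊓ n < o
  m+n≡o+o∧m≢o⇒m⊓n<o {m} {n} {o} eq m≢o with <-cmp m o
  ... | tri< m<o _ _ = ≤-<-trans (m⊓n≤m m n) m<o
  ... | tri≈ _ m≡o _ = contradiction m≡o m≢o
  ... | tri> _ _ m>o = ≤-<-trans (m⊓n≤n m n) (+-cancelˡ-< o n o (begin-strict
      o + n <⟨ +-monoˡ-< n m>o ⟩
      m + n ≡⟨ eq ⟩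
      o + o ∎))
    where open ≤-Reasoning

  balance-max-small : ∀ d {i j} → j ≤ i → UniqueMaxBalance d j (i + i) j
  balance-max-small d {i} {j} j≤i = max-at 0 (≤-reflexive (m≤n⇒m∸n≡0 j≤I) , ℕ.z≤n) balance≡j others
    where
    j≤I : j ≤ i + i
    j≤I = ≤-trans j≤i (m≤m+n i i)
    balance≡j : balance j (i + i) 0 ≡ j
    balance≡j = m≤n⇒m⊓n≡m (m+n≤o⇒m≤o∸n j (subst (j + j ≤_) (sym (+-identityʳ (i + i))) (+-mono-≤ j≤i j≤i)))
    others : ∀ s → InRange d j (i + i) s → s ≢ 0 → balance j (i + i) s < j
    others s (_ , s≤hi) s≢0 = ≤-<-trans (m⊓n≤m _ _) (∸-monoʳ-< (n≢0⇒n>0 s≢0) (≤-trans s≤hi (m⊓n≤m j _)))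

  balance-max-middle : ∀ d {i j} → i ≤ j → j ≤ d ∸ i → UniqueMaxBalance d j (i + i) i
  balance-max-middle d {i} {j} i≤j j≤d∸i = max-at s* s*∈ balance≡i others
    where
    s* = j ∸ i
    s*∈ : InRange d j (i + i) s*
    s*∈ = ∸-monoʳ-≤ j (m≤m+n i i) ,
          ⊓-glb (m∸n≤m j i) (subst (s* ≤_) (∸-+-assoc d i i) (∸-monoˡ-≤ i j≤d∸i))
    first-part : j ∸ s* ≡ i
    first-part = m∸[m∸n]≡n i≤j
    balance≡i : balance j (i + i) s* ≡ i
    balance≡i = trans (cong₂ _⊓_ first-part
                         (+-cancelˡ-≡ i _ _ (trans (cong (_+ (i + i + s* ∸ j)) (sym first-part)) (parts-sum s*∈))))
                      (⊓-idem i)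
    others : ∀ s → InRange d j (i + i) s → s ≢ s* → balance j (i + i) s < i
    others s s∈@(_ , s≤hi) s≢s* = m+n≡o+o∧m≢o⇒m⊓n<o (parts-sum s∈)
      (λ eq → s≢s* (∸-cancelˡ-≡ (≤-trans s≤hi (m⊓n≤m j _)) (m∸n≤m j i) (trans eq (sym first-part))))

  balance-max-large : ∀ {d i j} → i + i ≤ d → d ∸ i < j → j ≤ d → UniqueMaxBalance d j (i + i) (d ∸ j)
  balance-max-large {d} {i} {j} I≤d d∸i<j j≤d = max-at s* s*∈ balance≡d∸j others
    where
    s* = d ∸ (i + i)
    d∸i≡i+s* : d ∸ i ≡ i + s*
    d∸i≡i+s* = begin
      d ∸ i            ≡⟨ cong (_∸ i) (m+[n∸m]≡n I≤d) ⟨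
      (i + i) + s* ∸ i ≡⟨ cong (_∸ i) (+-assoc i i s*) ⟩
      i + (i + s*) ∸ i ≡⟨ m+n∸m≡n i (i + s*) ⟩
      i + s*           ∎
      where open ≡-Reasoning
    s*<j : s* < j
    s*<j = ≤-<-trans (subst (s* ≤_) (sym d∸i≡i+s*) (m≤n+m s* i)) d∸i<j
    s*∈ : InRange d j (i + i) s*
    s*∈ = ∸-monoˡ-≤ (i + i) j≤d , ⊓-glb (<⇒≤ s*<j) ≤-refl
    second-part : i + i + s* ∸ j ≡ d ∸ j
    second-part = cong (_∸ j) (m+[n∸m]≡n I≤d)
    d∸j<i : d ∸ j < i
    d∸j<i = +-cancelʳ-< j (d ∸ j) i (begin-strict
      d ∸ j + j   ≡⟨ m∸n+n≡m j≤d ⟩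
      d           ≤⟨ m≤n+m∸n d i ⟩
      i + (d ∸ i) <⟨ +-monoʳ-< i d∸i<j ⟩
      i + j       ∎)
      where open ≤-Reasoning
    d∸j≤first-part : d ∸ j ≤ j ∸ s*
    d∸j≤first-part = m+n≤o⇒m≤o∸n (d ∸ j) (<⇒≤ (begin-strict
      d ∸ j + s* <⟨ +-monoˡ-< s* d∸j<i ⟩
      i + s*     ≡⟨ d∸i≡i+s* ⟨
      d ∸ i      <⟨ d∸i<j ⟩
      j          ∎))
      where open ≤-Reasoning
    balance≡d∸j : balance j (i + i) s* ≡ d ∸ j
    balance≡d∸j = trans (cong ((j ∸ s*) ⊓_) second-part) (m≥n⇒m⊓n≡n d∸j≤first-part)
    others : ∀ s → InRange d j (i + i) s → s ≢ s* → balance j (i + i) s < d ∸ j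
    others s (lo≤s , s≤hi) s≢s* = ≤-<-trans (m⊓n≤n _ _) (subst (i + i + s ∸ j <_) second-part
      (∸-monoˡ-< (+-monoʳ-< (i + i) (≤∧≢⇒< (≤-trans s≤hi (m⊓n≤n j s*)) s≢s*))
                 (≤-trans (m≤n+m∸n j (i + i)) (+-monoʳ-≤ (i + i) lo≤s))))

  module _ (q : ℕ) (1<q : 1 < q) where

    P-leading : ∀ d j i s* → InRange d j i s* →
                (∀ s → InRange d j i s → s ≢ s* → balance j i s < balance j i s*) →
                HasLeadingExponent q (P q d j i) (exponent j i s*)
    P-leading d j i s* s*∈@(lo≤s* , s*≤hi) dominant with term-leading q 1<q d j i s*
    ... | n , lead = n , subst (_≡ _ mod _) (sym (P≡∑ q d j i))
      (≡-mod-trans (∑-range-≡-single-mod (j ∸ i) (j ⊓ (d ∸ i)) (term q d j i) lo≤s* s*≤hi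
        (λ s lo≤s s≤hi s≢s* → term-≡0-mod q d j i s
           (exponent-<-of-balance-< (lo≤s , s≤hi) s*∈ (dominant s (lo≤s , s≤hi) s≢s*))))
        lead)

    private
      P-≢-of-balance-< : ∀ {d j j′ i w w′} → UniqueMaxBalance d j i w → UniqueMaxBalance d j′ i w′ →
                         w < w′ → P q d j′ i ≢ P q d j i
      P-≢-of-balance-< {d} {j} {j′} {i} (max-at s s∈ refl dom) (max-at s′ s′∈ refl dom′) w<w′ =
        leading-≢ q 1<q (P-leading d j′ i s′ s′∈ dom′) (P-leading d j i s s∈ dom)
          (exponent-<-of-balance-< s∈ s′∈ w<w′)

    P-≢-of-balance-≢ : ∀ {d j j′ i w w′} → UniqueMaxBalance d j i w → UniqueMaxBalance d j′ i w′ →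
                       w ≢ w′ → P q d j i ≢ P q d j′ i
    P-≢-of-balance-≢ {w = w} {w′} max max′ w≢w′ with <-cmp w w′
    ... | tri< w<w′ _ _ = ≢-sym (P-≢-of-balance-< max max′ w<w′)
    ... | tri≈ _ w≡w′ _ = contradiction w≡w′ w≢w′
    ... | tri> _ _ w>w′ = P-≢-of-balance-< max′ max w>w′

open Balance

module EigenvaluesOfA₂ where

  open import Data.Nat as ℕ using (ℕ; zero; suc; _∸_; _<_; _≤_; _⊓_; s≤s; z≤n; z<s)
  open import Data.Nat.Properties
  import Data.Nat.Tactic.RingSolver as ℕ-Solver
  open import Data.Nat.Combinatorics using (_C_)
  open import Data.Integer as ℤ using (ℤ; +_; _+_; _*_; _-_; -_; _^_; 1ℤ; 0ℤ; ∣_∣)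
  import Data.Integer.Properties as ℤ
  open import Data.Integer.Tactic.RingSolver using (solve-∀)

  pos-^ : ∀ m n → + (m ℕ.^ n) ≡ (+ m) ^ n
  pos-^ m zero    = refl
  pos-^ m (suc n) = trans (ℤ.pos-* m (m ℕ.^ n)) (cong (+ m *_) (pos-^ m n))

  sign[m+n+m]≡sign[n] : ∀ m n → sign (m ℕ.+ n ℕ.+ m) ≡ sign n
  sign[m+n+m]≡sign[n] zero    n = cong sign (+-identityʳ n)
  sign[m+n+m]≡sign[n] (suc m) n = trans (cong (λ k → sign (suc k)) (+-suc (m ℕ.+ n) m)) (sign[m+n+m]≡sign[n] m n)

  module _ (q : ℕ) where

    private
      Q : ℤ
      Q = + q

    +qBinomial-suc : ∀ c b →
      + qBinomial q (suc c) (suc b) ≡ + qBinomial q (suc c) b + Q ^ suc b * + qBinomial q c (suc b)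
    +qBinomial-suc c b = trans (ℤ.pos-+ (qBinomial q (suc c) b) _)
      (cong (_+_ (+ qBinomial q (suc c) b))
            (trans (ℤ.pos-* (q ℕ.^ suc b) _) (cong (_* + qBinomial q c (suc b)) (pos-^ q (suc b)))))

    qBinomial₁-closed : ∀ n → + qBinomial q 1 n * (Q - 1ℤ) ≡ Q ^ suc n - 1ℤ
    qBinomial₁-closed zero    = base Q
      where
      base : ∀ Q → 1ℤ * (Q - 1ℤ) ≡ Q * 1ℤ - 1ℤ
      base = solve-∀
    qBinomial₁-closed (suc n) = begin
      + qBinomial q 1 (suc n) * (Q - 1ℤ)                 ≡⟨ cong (_* (Q - 1ℤ)) (+qBinomial-suc 0 n) ⟩
      (+ qBinomial q 1 n + Q ^ suc n * 1ℤ) * (Q - 1ℤ)     ≡⟨ distrib (+ qBinomial q 1 n) (Q ^ suc n) Q ⟩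
      + qBinomial q 1 n * (Q - 1ℤ) + Q ^ suc n * (Q - 1ℤ) ≡⟨ cong (_+ Q ^ suc n * (Q - 1ℤ)) (qBinomial₁-closed n) ⟩
      Q ^ suc n - 1ℤ + Q ^ suc n * (Q - 1ℤ)              ≡⟨ telescope (Q ^ suc n) Q ⟩
      Q * Q ^ suc n - 1ℤ                                 ∎
      where
      open ≡-Reasoning
      distrib : ∀ g x Q → (g + x * 1ℤ) * (Q - 1ℤ) ≡ g * (Q - 1ℤ) + x * (Q - 1ℤ)
      distrib = solve-∀
      telescope : ∀ x Q → x - 1ℤ + x * (Q - 1ℤ) ≡ Q * x - 1ℤ
      telescope = solve-∀

    qBinomial₂-closed : ∀ n →
      + qBinomial q 2 n * ((Q - 1ℤ) * (Q * Q - 1ℤ)) ≡ (Q ^ suc n - 1ℤ) * (Q ^ suc (suc n) - 1ℤ)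
    qBinomial₂-closed zero    = base Q
      where
      base : ∀ Q → 1ℤ * ((Q - 1ℤ) * (Q * Q - 1ℤ)) ≡ (Q * 1ℤ - 1ℤ) * (Q * (Q * 1ℤ) - 1ℤ)
      base = solve-∀
    qBinomial₂-closed (suc n) = begin
      + qBinomial q 2 (suc n) * K
        ≡⟨ cong (_* K) (+qBinomial-suc 1 n) ⟩
      (+ qBinomial q 2 n + Q ^ suc n * + qBinomial q 1 (suc n)) * K
        ≡⟨ distrib (+ qBinomial q 2 n) (Q ^ suc n) (+ qBinomial q 1 (suc n)) Q ⟩
      + qBinomial q 2 n * K + Q ^ suc n * (+ qBinomial q 1 (suc n) * (Q - 1ℤ)) * (Q * Q - 1ℤ)
        ≡⟨ cong₂ (λ x y → x + Q ^ suc n * y * (Q * Q - 1ℤ)) (qBinomial₂-closed n) (qBinomial₁-closed (suc n)) ⟩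
      (Q ^ suc n - 1ℤ) * (Q * Q ^ suc n - 1ℤ) + Q ^ suc n * (Q * Q ^ suc n - 1ℤ) * (Q * Q - 1ℤ)
        ≡⟨ telescope (Q ^ suc n) Q ⟩
      (Q * Q ^ suc n - 1ℤ) * (Q * (Q * Q ^ suc n) - 1ℤ) ∎
      where
      open ≡-Reasoning
      K = (Q - 1ℤ) * (Q * Q - 1ℤ)
      distrib : ∀ g x h Q → (g + x * h) * ((Q - 1ℤ) * (Q * Q - 1ℤ)) ≡
                            g * ((Q - 1ℤ) * (Q * Q - 1ℤ)) + x * (h * (Q - 1ℤ)) * (Q * Q - 1ℤ)
      distrib = solve-∀
      telescope : ∀ x Q → (x - 1ℤ) * (Q * x - 1ℤ) + x * (Q * x - 1ℤ) * (Q * Q - 1ℤ) ≡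
                          (Q * x - 1ℤ) * (Q * (Q * x) - 1ℤ)
      telescope = solve-∀

  module _ (q : ℕ) (1<q : 1 < q) where

    term-shape : ∀ {d j i s α β γ δ} → s ℕ.+ α ≡ j → d ∸ i ∸ s ≡ γ → γ ℕ.+ β ≡ d ∸ j → i ℕ.+ s ∸ j ≡ δ →
      term q d j i s ≡ sign α * (+ qBinomial q α s * + qBinomial q β γ * (+ q) ^ (α C 2 ℕ.+ δ C 2))
    term-shape {d} {i = i} {s} {α} {β} {γ} refl refl γ+β≡d∸j refl =
      cong₂ _*_ (sign[m+n+m]≡sign[n] s α) (trans (cong +_ (cong₂ ℕ._*_ (cong₂ ℕ._*_ first second) power))
                                                 (pos-*³ (qBinomial q α s) (qBinomial q β γ)))
      where
      e = α C 2 ℕ.+ (i ℕ.+ s ∸ (s ℕ.+ α)) C 2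
      first : gauss q (s ℕ.+ α) s ≡ qBinomial q α s
      first = trans (gauss≡qBinomial q 1<q (s ℕ.+ α) s) (cong (λ c → qBinomial q c s) (m+n∸m≡n s α))
      second : gauss q (d ∸ (s ℕ.+ α)) γ ≡ qBinomial q β γ
      second = trans (gauss≡qBinomial q 1<q (d ∸ (s ℕ.+ α)) γ)
                     (cong (λ c → qBinomial q c γ) (trans (cong (_∸ γ) (sym γ+β≡d∸j)) (m+n∸m≡n γ β)))
      power : q ℕ.^ exponent (s ℕ.+ α) i s ≡ q ℕ.^ e
      power = cong (λ a → q ℕ.^ (a C 2 ℕ.+ (i ℕ.+ s ∸ (s ℕ.+ α)) C 2)) (m+n∸m≡n s α)
      pos-*³ : ∀ x y → + (x ℕ.* y ℕ.* q ℕ.^ e) ≡ + x * + y * (+ q) ^ e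
      pos-*³ x y = trans (ℤ.pos-* (x ℕ.* y) _) (cong₂ _*_ (ℤ.pos-* x y) (pos-^ q e))

    private
      module _ (a b : ℕ) where

        Q A B K : ℤ
        Q = + q
        A = Q ^ suc a
        B = Q ^ suc b
        K = (Q - 1ℤ) * (Q * Q - 1ℤ)

        j d : ℕ
        j = suc (suc a)
        d = j ℕ.+ suc (suc b)

        G₁ G₂ : ℕ → ℤ
        G₁ n = + qBinomial q 1 n
        G₂ n = + qBinomial q 2 n

        P[2+a,2]≡ : P q d j 2 ≡ Q * G₂ a - G₁ (suc a) * G₁ (suc b) + Q * G₂ b
        P[2+a,2]≡ = begin
          P q d j 2
            ≡⟨ P≡∑ q d j 2 ⟩
          ∑ (suc (j ⊓ (d ∸ 2)) ∸ a) (λ t → term q d j 2 (a ℕ.+ t))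
            ≡⟨ cong (λ n → ∑ n (λ t → term q d j 2 (a ℕ.+ t))) three-terms ⟩
          term q d j 2 (a ℕ.+ 0) + (term q d j 2 (a ℕ.+ 1) + (term q d j 2 (a ℕ.+ 2) + 0ℤ))
            ≡⟨ cong₂ _+_ (trans (cong (term q d j 2) (+-identityʳ a)) first)
                         (cong₂ _+_ (trans (cong (term q d j 2) (+-comm a 1)) middle)
                                    (cong (_+ 0ℤ) (trans (cong (term q d j 2) (+-comm a 2)) last))) ⟩
          1ℤ * (G₂ a * 1ℤ * (Q * 1ℤ))
            + (- 1ℤ * (G₁ (suc a) * G₁ (suc b) * 1ℤ) + (1ℤ * (1ℤ * G₂ b * (Q * 1ℤ)) + 0ℤ))
            ≡⟨ normalise Q (G₂ a) (G₁ (suc a)) (G₁ (suc b)) (G₂ b) ⟩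
          Q * G₂ a - G₁ (suc a) * G₁ (suc b) + Q * G₂ b ∎
          where
          open ≡-Reasoning
          d∸j≡2+b : d ∸ j ≡ suc (suc b)
          d∸j≡2+b = m+n∸m≡n a (suc (suc b))
          three-terms : suc (j ⊓ (d ∸ 2)) ∸ a ≡ 3
          three-terms = trans (cong (λ h → suc h ∸ a) (m≤n⇒m⊓n≡m j≤d∸2)) (m+n∸n≡m 3 a)
            where
            j≤d∸2 : j ≤ a ℕ.+ suc (suc b)
            j≤d∸2 = ≤-trans (≤-reflexive (+-comm 2 a)) (+-monoʳ-≤ a (s≤s (s≤s z≤n)))
          first : term q d j 2 a ≡ 1ℤ * (G₂ a * 1ℤ * (Q * 1ℤ))
          first = term-shape {d = d} {i = 2} {α = 2} {β = 0} (+-comm a 2) (m+n∸m≡n a (suc (suc b)))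
                    (trans (+-identityʳ _) (sym d∸j≡2+b)) (n∸n≡0 j)
          middle : term q d j 2 (suc a) ≡ - 1ℤ * (G₁ (suc a) * G₁ (suc b) * 1ℤ)
          middle = term-shape {d = d} {i = 2} {α = 1} {β = 1} (cong suc (+-comm a 1))
                     (trans (cong (_∸ suc a) (+-suc a (suc b))) (m+n∸m≡n a (suc b)))
                     (trans (+-comm (suc b) 1) (sym d∸j≡2+b)) (m+n∸n≡m 1 a)
          last : term q d j 2 (suc (suc a)) ≡ 1ℤ * (1ℤ * G₂ b * (Q * 1ℤ))
          last = term-shape {d = d} {i = 2} {α = 0} {β = 2} (+-identityʳ j)
                   (trans (cong (_∸ suc (suc a)) (trans (+-suc a (suc b)) (cong suc (+-suc a b)))) (m+n∸m≡n a b))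
                   (trans (+-comm b 2) (sym d∸j≡2+b)) (m+n∸n≡m 2 a)
          normalise : ∀ Q x y z w →
            1ℤ * (x * 1ℤ * (Q * 1ℤ)) + (- 1ℤ * (y * z * 1ℤ) + (1ℤ * (1ℤ * w * (Q * 1ℤ)) + 0ℤ)) ≡
            Q * x - y * z + Q * w
          normalise = solve-∀

        P[1,2]≡ : P q d 1 2 ≡ Q * G₂ (a ℕ.+ suc b) - G₁ (a ℕ.+ suc (suc b))
        P[1,2]≡ = begin
          P q d 1 2
            ≡⟨ P≡∑ q d 1 2 ⟩
          ∑ (suc (1 ⊓ (d ∸ 2))) (term q d 1 2)
            ≡⟨ cong (λ n → ∑ n (term q d 1 2)) two-terms ⟩
          term q d 1 2 0 + (term q d 1 2 1 + 0ℤ)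
            ≡⟨ cong₂ _+_ first (cong (_+ 0ℤ) second) ⟩
          - 1ℤ * (1ℤ * G₁ (a ℕ.+ suc (suc b)) * 1ℤ) + (1ℤ * (1ℤ * G₂ (a ℕ.+ suc b) * (Q * 1ℤ)) + 0ℤ)
            ≡⟨ normalise Q (G₁ (a ℕ.+ suc (suc b))) (G₂ (a ℕ.+ suc b)) ⟩
          Q * G₂ (a ℕ.+ suc b) - G₁ (a ℕ.+ suc (suc b)) ∎
          where
          open ≡-Reasoning
          two-terms : suc (1 ⊓ (d ∸ 2)) ≡ 2
          two-terms = cong suc (m≤n⇒m⊓n≡m (≤-trans (s≤s z≤n) (m≤n+m (suc (suc b)) a)))
          first : term q d 1 2 0 ≡ - 1ℤ * (1ℤ * G₁ (a ℕ.+ suc (suc b)) * 1ℤ)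
          first = term-shape {d = d} {i = 2} {s = 0} {α = 1} {β = 1} refl refl (+-comm _ 1) refl
          second : term q d 1 2 1 ≡ 1ℤ * (1ℤ * G₂ (a ℕ.+ suc b) * (Q * 1ℤ))
          second = term-shape {d = d} {i = 2} {s = 1} {α = 0} {β = 2} refl (cong (_∸ 1) (+-suc a (suc b)))
                     (shift a b) refl
            where
            shift : ∀ a b → a ℕ.+ suc b ℕ.+ 2 ≡ suc (a ℕ.+ suc (suc b))
            shift = ℕ-Solver.solve-∀
          normalise : ∀ Q x y → - 1ℤ * (1ℤ * x * 1ℤ) + (1ℤ * (1ℤ * y * (Q * 1ℤ)) + 0ℤ) ≡ Q * y - x
          normalise = solve-∀

        K*[P[1,2]-P[2+a,2]] : K * (P q d 1 2 - P q d j 2) ≡ Q * Q * (A * A - 1ℤ) * (B * B - 1ℤ)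
        K*[P[1,2]-P[2+a,2]] = begin
          K * (P q d 1 2 - P q d j 2)
            ≡⟨ cong₂ (λ x y → K * (x - y)) P[1,2]≡ P[2+a,2]≡ ⟩
          K * (Q * G₂ (a ℕ.+ suc b) - G₁ (a ℕ.+ suc (suc b)) - (Q * G₂ a - G₁ (suc a) * G₁ (suc b) + Q * G₂ b))
            ≡⟨ expand Q (G₂ (a ℕ.+ suc b)) (G₁ (a ℕ.+ suc (suc b))) (G₂ a) (G₁ (suc a)) (G₁ (suc b)) (G₂ b) ⟩
          Q * (G₂ (a ℕ.+ suc b) * K) - G₁ (a ℕ.+ suc (suc b)) * (Q - 1ℤ) * (Q * Q - 1ℤ) - Q * (G₂ a * K)
            + G₁ (suc a) * (Q - 1ℤ) * (G₁ (suc b) * (Q - 1ℤ)) * (Q + 1ℤ) - Q * (G₂ b * K)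
            ≡⟨ cong₂ _-_ (cong₂ _+_ (cong₂ _-_ (cong₂ _-_ (cong (Q *_) G₂[a+1+b])
                                                          (cong (_* (Q * Q - 1ℤ)) G₁[a+2+b]))
                                               (cong (Q *_) (qBinomial₂-closed q a)))
                                    (cong (_* (Q + 1ℤ)) (cong₂ _*_ (qBinomial₁-closed q (suc a))
                                                                   (qBinomial₁-closed q (suc b)))))
                         (cong (Q *_) (qBinomial₂-closed q b)) ⟩
          Q * ((A * B - 1ℤ) * (Q * (A * B) - 1ℤ)) - (Q * (A * B) - 1ℤ) * (Q * Q - 1ℤ) - Q * ((A - 1ℤ) * (Q * A - 1ℤ))
            + (Q * A - 1ℤ) * (Q * B - 1ℤ) * (Q + 1ℤ) - Q * ((B - 1ℤ) * (Q * B - 1ℤ))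
            ≡⟨ collapse Q A B ⟩
          Q * Q * (A * A - 1ℤ) * (B * B - 1ℤ) ∎
          where
          open ≡-Reasoning
          AB : Q ^ suc (a ℕ.+ suc b) ≡ A * B
          AB = ℤ.^-distribˡ-+-* Q (suc a) (suc b)
          G₂[a+1+b] : G₂ (a ℕ.+ suc b) * K ≡ (A * B - 1ℤ) * (Q * (A * B) - 1ℤ)
          G₂[a+1+b] = trans (qBinomial₂-closed q (a ℕ.+ suc b)) (cong (λ x → (x - 1ℤ) * (Q * x - 1ℤ)) AB)
          G₁[a+2+b] : G₁ (a ℕ.+ suc (suc b)) * (Q - 1ℤ) ≡ Q * (A * B) - 1ℤ
          G₁[a+2+b] = trans (qBinomial₁-closed q (a ℕ.+ suc (suc b)))
                            (trans (cong (λ n → Q ^ suc n - 1ℤ) (+-suc a (suc b))) (cong (λ x → Q * x - 1ℤ) AB))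
          expand : ∀ Q g2d g1d g2a g1a g1b g2b →
            (Q - 1ℤ) * (Q * Q - 1ℤ) * (Q * g2d - g1d - (Q * g2a - g1a * g1b + Q * g2b)) ≡
            Q * (g2d * ((Q - 1ℤ) * (Q * Q - 1ℤ))) - g1d * (Q - 1ℤ) * (Q * Q - 1ℤ) - Q * (g2a * ((Q - 1ℤ) * (Q * Q - 1ℤ)))
              + g1a * (Q - 1ℤ) * (g1b * (Q - 1ℤ)) * (Q + 1ℤ) - Q * (g2b * ((Q - 1ℤ) * (Q * Q - 1ℤ)))
          expand = solve-∀
          collapse : ∀ Q A B →
            Q * ((A * B - 1ℤ) * (Q * (A * B) - 1ℤ)) - (Q * (A * B) - 1ℤ) * (Q * Q - 1ℤ) - Q * ((A - 1ℤ) * (Q * A - 1ℤ))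
              + (Q * A - 1ℤ) * (Q * B - 1ℤ) * (Q + 1ℤ) - Q * ((B - 1ℤ) * (Q * B - 1ℤ)) ≡
            Q * Q * (A * A - 1ℤ) * (B * B - 1ℤ)
          collapse = solve-∀

        P[2+a,2]≢P[1,2] : P q d j 2 ≢ P q d 1 2
        P[2+a,2]≢P[1,2] eq = ℕ.≢-nonZero⁻¹ ∣ lhs ∣ {{lhs≢0}} (cong ∣_∣ (begin
          lhs                         ≡⟨ K*[P[1,2]-P[2+a,2]] ⟨
          K * (P q d 1 2 - P q d j 2) ≡⟨ cong (λ x → K * (P q d 1 2 - x)) eq ⟩
          K * (P q d 1 2 - P q d 1 2) ≡⟨ cong (K *_) (ℤ.+-inverseʳ (P q d 1 2)) ⟩
          K * 0ℤ                      ≡⟨ ℤ.*-zeroʳ K ⟩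
          0ℤ                          ∎))
          where
          open ≡-Reasoning
          lhs = Q * Q * (A * A - 1ℤ) * (B * B - 1ℤ)
          square-1≢0 : ∀ n → 1 < n → ℤ.NonZero (+ n * + n - 1ℤ)
          square-1≢0 (suc (suc n)) _ = _
          square-1≢0 (suc zero) (s≤s ())
          power-square-1≢0 : ∀ n → ℤ.NonZero (Q ^ suc n * Q ^ suc n - 1ℤ)
          power-square-1≢0 n = subst (λ x → ℤ.NonZero (x * x - 1ℤ)) (pos-^ q (suc n))
                                 (square-1≢0 (q ℕ.^ suc n) (^-monoʳ-< q 1<q (z<s {n})))
          instance
            Q≢0 : ℤ.NonZero Q
            Q≢0 = ℕ.>-nonZero (<-trans z<s 1<q)
          lhs≢0 : ℤ.NonZero lhs
          lhs≢0 = ℤ.i*j≢0 (Q * Q * (A * A - 1ℤ)) (B * B - 1ℤ)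
            {{ℤ.i*j≢0 (Q * Q) (A * A - 1ℤ) {{ℤ.i*j≢0 Q Q}} {{power-square-1≢0 a}}}} {{power-square-1≢0 b}}

    P[j,2]≢P[1,2] : ∀ {d j} → 2 ≤ j → j ℕ.+ 2 ≤ d → P q d j 2 ≢ P q d 1 2
    P[j,2]≢P[1,2] 2≤j j+2≤d with m≤n⇒∃[o]m+o≡n 2≤j | m≤n⇒∃[o]m+o≡n j+2≤d
    ... | a , refl | b , refl =
      subst (λ d → P q d (2 ℕ.+ a) 2 ≢ P q d 1 2) (sym (+-assoc (2 ℕ.+ a) 2 b)) (P[2+a,2]≢P[1,2] a b)

open EigenvaluesOfA₂

module MainTheorem where

  open import Data.Nat
  open import Data.Nat.Properties
  open import Data.Nat.Primality using (Prime; prime⇒nonTrivial)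
  open import Relation.Nullary using (yes; no)

  P[j,i+i]≢P[1,i+i] : ∀ {q d i j} → 1 < q → 1 ≤ i → i + i ≤ d → j ≤ d → j ≢ 1 → j ≢ d ∸ 1 →
                      P q d j (i + i) ≢ P q d 1 (i + i)
  P[j,i+i]≢P[1,i+i] {q} {d} {i} {j} 1<q 1≤i I≤d j≤d j≢1 j≢d∸1 with j ≤? i | j ≤? d ∸ i | i ≟ 1
  ... | yes j≤i | _         | _        =
    P-≢-of-balance-≢ q 1<q (balance-max-small d j≤i) (balance-max-small d 1≤i) j≢1
  ... | no j≰i  | no j≰d∸i  | _        =
    P-≢-of-balance-≢ q 1<q (balance-max-large {i = i} I≤d (≰⇒> j≰d∸i) j≤d) (balance-max-small d 1≤i)
      (λ d∸j≡1 → j≢d∸1 (trans (sym (m∸[m∸n]≡n j≤d)) (cong (d ∸_) d∸j≡1)))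
  ... | no j≰i  | yes j≤d∸i | no i≢1   =
    P-≢-of-balance-≢ q 1<q (balance-max-middle d (<⇒≤ (≰⇒> j≰i)) j≤d∸i) (balance-max-small d 1≤i) i≢1
  ... | no j≰i  | yes j≤d∸1 | yes refl =
    P[j,2]≢P[1,2] q 1<q (≰⇒> j≰i)
      (subst (_≤ d) (trans (+-comm (suc j) 1) (+-comm 2 j)) (m≤o∸n⇒m+n≤o (suc j) 1≤d (≤∧≢⇒< j≤d∸1 j≢d∸1)))
    where
    1≤d : 1 ≤ d
    1≤d = ≤-trans (≤-trans (s≤s z≤n) (≰⇒> j≰i)) j≤d

  P[j,2i]≢P[1,2i] : ∀ {q d i j} → 1 < q → 1 ≤ i → 2 * i ≤ d → j ≤ d → j ≢ 1 → j ≢ d ∸ 1 →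
                    P q d j (2 * i) ≢ P q d 1 (2 * i)
  P[j,2i]≢P[1,2i] {q} {d} {i} {j} 1<q 1≤i 2i≤d =
    subst (λ I → I ≤ d → j ≤ d → j ≢ 1 → j ≢ d ∸ 1 → P q d j I ≢ P q d 1 I) (sym 2i≡i+i)
      (P[j,i+i]≢P[1,i+i] 1<q 1≤i) 2i≤d
    where
    2i≡i+i : 2 * i ≡ i + i
    2i≡i+i = cong (i +_) (+-identityʳ i)

  1<p^[1+k] : ∀ {p} k → Prime p → 1 < p ^ suc k
  1<p^[1+k] {p} k p-prime = ^-monoʳ-< p (nonTrivial⇒n>1 p {{prime⇒nonTrivial p-prime}}) (z<s {k})

open MainTheorem

open import Data.Nat using (ℕ; suc; _*_; _∸_; _^_; _≤_)
open import Data.Nat.Properties using (*-monoʳ-≤)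
open import Data.Nat.Primality using (Prime)

lemma4p1 : (p k q m i j : ℕ) → Prime p → q ≡ p ^ suc k →
           1 ≤ i → i ≤ m → j ≤ 2 * m → j ≢ 1 → j ≢ 2 * m ∸ 1 →
           P q (2 * m) j (2 * i) ≢ P q (2 * m) 1 (2 * i)
lemma4p1 p k q m i j p-prime refl 1≤i i≤m = P[j,2i]≢P[1,2i] (1<p^[1+k] k p-prime) 1≤i (*-monoʳ-≤ 2 i≤m)
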